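{- Let $n<m<2^n$ be positive integers and let $J_1,\ldots,J_m\subseteq[n]=\{1,\ldots,n\}$ satisfy \[ |J_1|+\cdots+|J_m| < m\Bigl(\log\Bigl(\frac{m}{n-\log m+1}\Bigr)-1\Bigr), \] where $\log$ is to base $2$. Then $J_1,\ldots,J_m$ has a covering assignment, i.e. there are functions $f_i:J_i\to\{0,1\}$ ($1\le i\le m$) such that every vector $v\in\{0,1\}^n$ satisfies $v|_{J_i}=f_i$ for some $i$.
   Context: For $v\in\{0,1\}^n$ and $J\subseteq[n]$, $v|_J$ denotes the restriction of $v$ (viewed as a function $[n]\to\{0,1\}$) to $J$. -}

module Defs where

open import Data.Nat using (ℕ; zero; suc; _+_; _*_; _∸_; _^_; _<_; _≤_)
open import Data.Bool using (Bool)
open import Data.Fin using (Fin)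
open import Data.Fin.Subset using (Subset; _∈_; ∣_∣)
open import Data.Vec.Functional using (foldr)
open import Data.Product using (Σ; ∃; _×_)
open import Relation.Binary.PropositionalEquality using (_≡_)

totalSize : ∀ {n m} → (Fin m → Subset n) → ℕ
totalSize J = foldr (λ s acc → ∣ s ∣ + acc) 0 J

-- Exact integer encoding of the real inequality (log = log₂, L = log₂ m)
--   S < m (log₂ (m / (n - L + 1)) - 1)
-- Under n < m < 2^n we have 1 ≤ L < n, so n - L + 1 > 0, and with
-- c = m · 2^(-(S+m)/m) > 0 the inequality is equivalent to
--   L > n + 1 - c.
-- As both sides are real and L > 0, this holds iff there is a rational
-- q = p/d ≥ 0 (d ≥ 1) with  n + 1 - c < q < L, i.e.
--   q < L             ⇔  2^p < m^d
--   n + 1 - p/d < c   ⇔  (d(n+1) - p)^m · 2^(S+m) < (m·d)^m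
-- (the second trivially holds when d(n+1) ≤ p, matching truncated ∸).
LogBound : (n m S : ℕ) → Set
LogBound n m S =
  Σ ℕ λ p → Σ ℕ λ d →
    (1 ≤ d) ×
    (2 ^ p < m ^ d) ×
    ((d * (n + 1) ∸ p) ^ m * 2 ^ (S + m) < (m * d) ^ m)

Assignment : ∀ {n m} → (Fin m → Subset n) → Set
Assignment {n} {m} J = (i : Fin m) → (j : Fin n) → j ∈ J i → Bool

Restricts : ∀ {n m} (J : Fin m → Subset n) → Assignment J →
            (Fin n → Bool) → Fin m → Set
Restricts {n} J f v i = (j : Fin n) (h : j ∈ J i) → v j ≡ f i j h

IsCovering : ∀ {n m} (J : Fin m → Subset n) → Assignment J → Set
IsCovering {n} {m} J f = (v : Fin n → Bool) → ∃ λ (i : Fin m) → Restricts J f v i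

HasCoveringAssignment : ∀ {n m} → (Fin m → Subset n) → Set
HasCoveringAssignment J = ∃ λ f → IsCovering J f

-- Let N = 2^n, a_i = 2^(n - |J_i|) (the number of vectors with a prescribed restriction to J_i), and
-- write the hypothesis as p/d < log m and (d(n + 1) - p) · 2^((S + m)/m) < m d. Split the sets into two
-- halves of sizes differing by at most one. By AM-GM, Σ a_i ≥ m (Π a_i)^(1/m) = m N 2^(-S/m), which
-- the hypothesis bounds below by 2 N (n + 1 - p/d), so one half has weight T = Σ a_i ≥ N (n + 1 - p/d).
-- Its sets choose patterns greedily, each agreeing with at least a 2^(-|J_i|) = a_i/N fraction of the
-- vectors still uncovered; by Bernoulli's inequality at most N (1 - 1/N)^T ≤ N 2^(-(n + 1 - p/d)) < m/2
-- vectors survive, and the sets of the other half cover them one at a time.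

module Submission where

import Algebra.Properties.CommutativeMonoid.Sum as MonoidSum
import Algebra.Properties.CommutativeSemigroup as CommutativeSemigroup
open import Data.Bool using (Bool; true; false; T; _∧_; if_then_else_)
open import Data.Bool.Properties using (T-∧) renaming (_≟_ to _≟ᵇ_)
open import Data.Fin using (Fin; zero; suc; _↑ˡ_; _↑ʳ_)
open import Data.Fin.Subset using (Subset; inside; outside; ∣_∣) renaming (_∈_ to _∈ₛ_)
open import Data.Fin.Subset.Properties using (∣p∣≤n)
open import Data.List using (List; []; _∷_; length; map; _++_; filter)
open import Data.List.Membership.Propositional using (_∈_)
open import Data.List.Membership.Propositional.Properties using (∈-map⁺; ∈-++⁺ˡ; ∈-++⁺ʳ; ∈-filter⁺)
open import Data.List.Properties using (length-map; length-++)
open import Data.List.Relation.Unary.Any using (here; there)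
open import Data.Nat
open import Data.Nat.Properties
open import Data.Nat.Tactic.RingSolver using (solve-∀)
open import Data.Product using (∃; ∃₂; _×_; _,_; proj₁; proj₂)
open import Data.Sum using (_⊎_; inj₁; inj₂; [_,_]′; map₁; swap)
open import Data.Vec using (Vec; []; _∷_; lookup; tail; replicate; tabulate; here; there)
import Data.Vec.Functional as Vector
open import Data.Vec.Functional.Properties using (lookup-++ˡ; lookup-++ʳ)
open import Data.Vec.Properties using (lookup∘tabulate)
open import Function using (_∘_)
open import Function.Bundles using (Equivalence)
open import Relation.Binary.PropositionalEquality hiding ([_])
open import Relation.Nullary using (yes; no; does)
open import Relation.Nullary.Decidable using (isYes; toWitness; fromWitness; T?)
open import Relation.Unary using (Pred; Decidable)
open import Relation.Unary.Properties using (∁?)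

open import Defs

open CommutativeSemigroup *-commutativeSemigroup using (interchange; xy∙z≈xz∙y; x∙yz≈xz∙y)
open MonoidSum +-0-commutativeMonoid using (sum)
open MonoidSum *-1-commutativeMonoid using () renaming (sum to product)

^-distribʳ-* : ∀ m n o → (m * n) ^ o ≡ m ^ o * n ^ o
^-distribʳ-* m n zero    = refl
^-distribʳ-* m n (suc o) = begin
  m * n * (m * n) ^ o      ≡⟨ cong (m * n *_) (^-distribʳ-* m n o) ⟩
  m * n * (m ^ o * n ^ o)  ≡⟨ interchange m n (m ^ o) (n ^ o) ⟩
  m * m ^ o * (n * n ^ o)  ∎
  where open ≡-Reasoning

^-cancelʳ-< : ∀ m {x y} → x ^ m < y ^ m → x < y
^-cancelʳ-< m x^m<y^m = ≰⇒> (λ y≤x → <⇒≱ x^m<y^m (^-monoˡ-≤ m y≤x))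

m+n≤2*m : ∀ {m n} → n ≤ m → m + n ≤ 2 * m
m+n≤2*m {m} n≤m = ≤-trans (+-monoʳ-≤ m n≤m) (≤-reflexive (cong (m +_) (sym (+-identityʳ m))))

2*x<y+z⇒x<y⊎x<z : ∀ {x y z} → 2 * x < y + z → x < y ⊎ x < z
2*x<y+z⇒x<y⊎x<z {x} {y} {z} 2x<y+z with x <? y
... | yes x<y = inj₁ x<y
... | no  x≮y = inj₂ (≰⇒> λ z≤x →
  <⇒≱ 2x<y+z (≤-trans (+-monoˡ-≤ z (≮⇒≥ x≮y)) (m+n≤2*m z≤x)))

bernoulli : ∀ x k → x ^ suc k + suc k * x ^ k ≤ suc x ^ suc k
bernoulli x zero    = ≤-reflexive (+-comm (x * 1) 1)
bernoulli x (suc k) = begin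
  x ^ suc (suc k) + suc (suc k) * x ^ suc k
    ≤⟨ m≤m+n _ (suc k * x ^ k) ⟩
  x ^ suc (suc k) + suc (suc k) * x ^ suc k + suc k * x ^ k
    ≡⟨ expand x (x ^ k) k ⟩
  suc x * (x ^ suc k + suc k * x ^ k)
    ≤⟨ *-monoʳ-≤ (suc x) (bernoulli x k) ⟩
  suc x ^ suc (suc k) ∎
  where
  open ≤-Reasoning
  expand : ∀ x y k → x * (x * y) + (2 + k) * (x * y) + (1 + k) * y ≡ (1 + x) * (x * y + (1 + k) * y)
  expand = solve-∀

2*x^[1+x]≤[1+x]^[1+x] : ∀ x → 2 * x ^ suc x ≤ suc x ^ suc x
2*x^[1+x]≤[1+x]^[1+x] x = begin
  2 * x ^ suc x             ≡⟨ cong (x ^ suc x +_) (+-identityʳ _) ⟩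
  x ^ suc x + x * x ^ x     ≤⟨ +-monoʳ-≤ (x ^ suc x) (*-monoˡ-≤ (x ^ x) (n≤1+n x)) ⟩
  x ^ suc x + suc x * x ^ x ≤⟨ bernoulli x x ⟩
  suc x ^ suc x             ∎
  where open ≤-Reasoning

2^k*[N-1]^e≤N^e : ∀ k N .{{_ : NonZero N}} {e} → k * N ≤ e → 2 ^ k * pred N ^ e ≤ N ^ e
2^k*[N-1]^e≤N^e zero    (suc x) {e} _ = ≤-trans (≤-reflexive (*-identityˡ (x ^ e))) (^-monoˡ-≤ e (n≤1+n x))
2^k*[N-1]^e≤N^e (suc k) (suc x) {e} h = begin
  2 ^ suc k * x ^ e                   ≡⟨ cong (λ e → 2 ^ suc k * x ^ e) e≡ ⟩
  2 * 2 ^ k * x ^ (suc x + e′)        ≡⟨ cong (2 * 2 ^ k *_) (^-distribˡ-+-* x (suc x) e′) ⟩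
  2 * 2 ^ k * (x ^ suc x * x ^ e′)    ≡⟨ interchange 2 (2 ^ k) (x ^ suc x) (x ^ e′) ⟩
  2 * x ^ suc x * (2 ^ k * x ^ e′)    ≤⟨ *-mono-≤ (2*x^[1+x]≤[1+x]^[1+x] x) (2^k*[N-1]^e≤N^e k (suc x) h′) ⟩
  suc x ^ suc x * suc x ^ e′          ≡⟨ ^-distribˡ-+-* (suc x) (suc x) e′ ⟨
  suc x ^ (suc x + e′)                ≡⟨ cong (suc x ^_) e≡ ⟨
  suc x ^ e                           ∎
  where
  open ≤-Reasoning
  e′ = e ∸ suc x
  e≡ : e ≡ suc x + e′
  e≡ = sym (m+[n∸m]≡n (≤-trans (m≤m+n (suc x) _) h))
  h′ : k * suc x ≤ e′
  h′ = +-cancelˡ-≤ (suc x) _ _ (≤-trans h (≤-reflexive e≡))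

-- (1 - 1/N)^a ≥ 1 - a/N for N = b + a and a = k + 1, multiplied by N^a.
bernoulli⁻ : ∀ k b → b * (b + suc k) ^ k ≤ (b + k) ^ suc k
bernoulli⁻ zero    b = ≤-reflexive (cong (_* 1) (sym (+-identityʳ b)))
bernoulli⁻ (suc k) b = begin
  b * (b + suc (suc k)) ^ suc k                  ≡⟨ *-assoc b _ _ ⟨
  b * (b + suc (suc k)) * (b + suc (suc k)) ^ k  ≤⟨ *-monoˡ-≤ _ b*[b+2+k]≤[b+1+k]*[1+b] ⟩
  (b + suc k) * suc b * (b + suc (suc k)) ^ k    ≡⟨ *-assoc (b + suc k) _ _ ⟩
  (b + suc k) * (suc b * (b + suc (suc k)) ^ k)  ≡⟨ cong (λ z → (b + suc k) * (suc b * z ^ k)) (+-suc b (suc k)) ⟩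
  (b + suc k) * (suc b * (suc b + suc k) ^ k)    ≤⟨ *-monoʳ-≤ (b + suc k) (bernoulli⁻ k (suc b)) ⟩
  (b + suc k) * (suc b + k) ^ suc k              ≡⟨ cong (λ z → (b + suc k) * z ^ suc k) (+-suc b k) ⟨
  (b + suc k) ^ suc (suc k)                      ∎
  where
  open ≤-Reasoning
  b*[b+2+k]≤[b+1+k]*[1+b] : b * (b + suc (suc k)) ≤ (b + suc k) * suc b
  b*[b+2+k]≤[b+1+k]*[1+b] = ≤-trans (m≤m+n _ (suc k)) (≤-reflexive (expand b k))
    where
    expand : ∀ b k → b * (b + (2 + k)) + (1 + k) ≡ (b + (1 + k)) * (1 + b)
    expand = solve-∀

-- u ≤ (1 - 1/q)(c + u), and 1 - 1/q = 1 - a/(q a) ≤ (1 - 1/(q a))^a by Bernoulli.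
remainder-bound : ∀ {q a} c u .{{_ : NonZero q}} .{{_ : NonZero a}} → c + u ≤ q * c →
                  u * (q * a) ^ a ≤ (c + u) * pred (q * a) ^ a
remainder-bound {suc t} {suc k} c u c+u≤qc = begin
  u * (suc t * a) ^ a                      ≡⟨ regroup u t a ((suc t * a) ^ k) ⟩
  u * suc t * (a * (suc t * a) ^ k)        ≤⟨ *-monoˡ-≤ _ u*q≤[c+u]*t ⟩
  (c + u) * t * (a * (suc t * a) ^ k)      ≡⟨ regroup′ (c + u) t a ((suc t * a) ^ k) ⟩
  (c + u) * (t * a * (suc t * a) ^ k)      ≡⟨ cong (λ z → (c + u) * (t * a * z ^ k)) (+-comm a (t * a)) ⟩
  (c + u) * (t * a * (t * a + a) ^ k)      ≤⟨ *-monoʳ-≤ (c + u) (bernoulli⁻ k (t * a)) ⟩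
  (c + u) * (t * a + k) ^ a                ≡⟨ cong (λ z → (c + u) * z ^ a) (+-comm (t * a) k) ⟩
  (c + u) * pred (suc t * a) ^ a           ∎
  where
  open ≤-Reasoning
  a = suc k
  u*q≤[c+u]*t : u * suc t ≤ (c + u) * t
  u*q≤[c+u]*t = begin
    u * suc t      ≡⟨ *-suc u t ⟩
    u + u * t      ≤⟨ +-monoˡ-≤ (u * t) (+-cancelˡ-≤ c _ _ c+u≤qc) ⟩
    t * c + u * t  ≡⟨ cong (_+ u * t) (*-comm t c) ⟩
    c * t + u * t  ≡⟨ *-distribʳ-+ t c u ⟨
    (c + u) * t    ∎
  regroup : ∀ u t a x → u * ((1 + t) * a * x) ≡ u * (1 + t) * (a * x)
  regroup = solve-∀
  regroup′ : ∀ v t a x → v * t * (a * x) ≡ v * (t * a * x)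
  regroup′ = solve-∀

2*m*n≤m*m+n*n : ∀ m n → 2 * (m * n) ≤ m * m + n * n
2*m*n≤m*m+n*n m n = [ ordered , swapped ]′ (≤-total m n)
  where
  ordered : ∀ {a b} → a ≤ b → 2 * (a * b) ≤ a * a + b * b
  ordered {a} a≤b with d , refl ← m≤n⇒∃[o]m+o≡n a≤b =
    ≤-trans (m≤m+n _ (d * d)) (≤-reflexive (expand a d))
    where
    expand : ∀ a d → 2 * (a * (a + d)) + d * d ≡ a * a + (a + d) * (a + d)
    expand = solve-∀
  swapped : n ≤ m → 2 * (m * n) ≤ m * m + n * n
  swapped n≤m = subst₂ _≤_ (cong (2 *_) (*-comm n m)) (+-comm (n * n) (m * m)) (ordered n≤m)

am-gm₂ : ∀ k a b → suc k * a * b ^ k ≤ a ^ suc k + k * b ^ suc k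
am-gm₂ zero    a b = ≤-reflexive (base a)
  where
  base : ∀ a → 1 * a * 1 ≡ a * 1 + 0
  base = solve-∀
am-gm₂ (suc k) a b = +-cancelʳ-≤ (k * a * b ^ suc k) _ _ (begin
  suc (suc k) * a * b ^ suc k + k * a * b ^ suc k   ≡⟨ factor k a b (b ^ k) ⟩
  suc k * b ^ k * (2 * (a * b))                     ≤⟨ *-monoʳ-≤ (suc k * b ^ k) (2*m*n≤m*m+n*n a b) ⟩
  suc k * b ^ k * (a * a + b * b)                   ≡⟨ expand k a b (b ^ k) ⟩
  a * (suc k * a * b ^ k) + suc k * b ^ suc (suc k) ≤⟨ +-monoˡ-≤ _ (*-monoʳ-≤ a (am-gm₂ k a b)) ⟩
  a * (a ^ suc k + k * b ^ suc k) + suc k * b ^ suc (suc k)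
                                                    ≡⟨ regroup k a b (b ^ k) (a ^ suc k) ⟩
  a ^ suc (suc k) + suc k * b ^ suc (suc k) + k * a * b ^ suc k ∎)
  where
  open ≤-Reasoning
  factor : ∀ k a b x → (2 + k) * a * (b * x) + k * a * (b * x) ≡ (1 + k) * x * (2 * (a * b))
  factor = solve-∀
  expand : ∀ k a b x → (1 + k) * x * (a * a + b * b) ≡ a * ((1 + k) * a * x) + (1 + k) * (b * (b * x))
  expand = solve-∀
  regroup : ∀ k a b x y → a * (y + k * (b * x)) + (1 + k) * (b * (b * x))
                        ≡ a * y + (1 + k) * (b * (b * x)) + k * a * (b * x)
  regroup = solve-∀

am-gm-step : ∀ k x y → suc k ^ suc k * y * x ^ k ≤ k ^ k * (x + y) ^ suc k
am-gm-step zero    x y = ≤-trans (m≤m+n _ x) (≤-reflexive (base x y))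
  where
  base : ∀ x y → 1 * 1 * y * 1 + x ≡ 1 * ((x + y) * 1)
  base = solve-∀
am-gm-step k@(suc _) x y = *-cancelˡ-≤ k (begin
  k * (suc k ^ suc k * y * x ^ k)   ≡⟨ regroup k y (suc k ^ k) (x ^ k) ⟩
  k * suc k * y * (suc k ^ k * x ^ k) ≡⟨ cong (k * suc k * y *_) (^-distribʳ-* (suc k) x k) ⟨
  k * suc k * y * b ^ k             ≤⟨ +-cancelˡ-≤ (k * b ^ suc k) _ _ (begin
      k * b ^ suc k + k * suc k * y * b ^ k ≡⟨ collect k x y (b ^ k) ⟩
      suc k * a * b ^ k                     ≤⟨ am-gm₂ k a b ⟩
      a ^ suc k + k * b ^ suc k             ≡⟨ +-comm (a ^ suc k) _ ⟩
      k * b ^ suc k + a ^ suc k             ∎) ⟩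
  a ^ suc k                         ≡⟨ ^-distribʳ-* k (x + y) (suc k) ⟩
  k ^ suc k * (x + y) ^ suc k       ≡⟨ *-assoc k (k ^ k) _ ⟩
  k * (k ^ k * (x + y) ^ suc k)     ∎)
  where
  open ≤-Reasoning
  a = k * (x + y)
  b = suc k * x
  regroup : ∀ k y p q → k * ((1 + k) * p * y * q) ≡ k * (1 + k) * y * (p * q)
  regroup = solve-∀
  collect : ∀ k x y z → k * ((1 + k) * x * z) + k * (1 + k) * y * z ≡ (1 + k) * (k * (x + y)) * z
  collect = solve-∀

am-gm : ∀ k (f : Fin k → ℕ) → k ^ k * product f ≤ sum f ^ k
am-gm zero    f = ≤-refl
am-gm (suc k) f = *-cancelˡ-≤ (k ^ k) {{k^k≢0 k}} (begin
  k ^ k * (suc k ^ suc k * (y * p))  ≡⟨ regroup (k ^ k) (suc k ^ suc k) y p ⟩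
  suc k ^ suc k * y * (k ^ k * p)    ≤⟨ *-monoʳ-≤ (suc k ^ suc k * y) (am-gm k (f ∘ suc)) ⟩
  suc k ^ suc k * y * x ^ k          ≤⟨ am-gm-step k x y ⟩
  k ^ k * (x + y) ^ suc k            ≡⟨ cong (λ z → k ^ k * z ^ suc k) (+-comm x y) ⟩
  k ^ k * (y + x) ^ suc k            ∎)
  where
  open ≤-Reasoning
  y = f zero
  p = product (f ∘ suc)
  x = sum (f ∘ suc)
  k^k≢0 : ∀ k → NonZero (k ^ k)
  k^k≢0 zero    = _
  k^k≢0 (suc k) = m^n≢0 (suc k) (suc k)
  regroup : ∀ a b y p → a * (b * (y * p)) ≡ b * y * (a * p)
  regroup = solve-∀

sum-↑ : ∀ c r (f : Fin (c + r) → ℕ) → sum f ≡ sum (f ∘ (_↑ˡ r)) + sum (f ∘ (c ↑ʳ_))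
sum-↑ zero    r f = refl
sum-↑ (suc c) r f = trans (cong (f zero +_) (sum-↑ c r (f ∘ suc))) (sym (+-assoc (f zero) _ _))

module _ {a p} {A : Set a} {P : Pred A p} (P? : Decidable P) where

  length-filter+filter-∁ : ∀ xs → length (filter P? xs) + length (filter (∁? P?) xs) ≡ length xs
  length-filter+filter-∁ []       = refl
  length-filter+filter-∁ (x ∷ xs) with does (P? x)
  ... | true  = cong suc (length-filter+filter-∁ xs)
  ... | false = trans (+-suc _ _) (cong suc (length-filter+filter-∁ xs))

  ∈⇒P⊎∈-filter-∁ : ∀ {x xs} → x ∈ xs → P x ⊎ x ∈ filter (∁? P?) xs
  ∈⇒P⊎∈-filter-∁ {x} x∈xs with P? x
  ... | yes px = inj₁ px
  ... | no ¬px = inj₂ (∈-filter⁺ (∁? P?) x∈xs ¬px)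

allVecs : ∀ n → List (Vec Bool n)
allVecs zero    = [] ∷ []
allVecs (suc n) = map (true ∷_) (allVecs n) ++ map (false ∷_) (allVecs n)

length-allVecs : ∀ n → length (allVecs n) ≡ 2 ^ n
length-allVecs zero    = refl
length-allVecs (suc n) = begin
  length (map (true ∷_) vs ++ map (false ∷_) vs)          ≡⟨ length-++ (map (true ∷_) vs) ⟩
  length (map (true ∷_) vs) + length (map (false ∷_) vs)  ≡⟨ cong₂ _+_ (length-map _ vs) (length-map _ vs) ⟩
  length vs + length vs                                    ≡⟨ cong (λ l → l + l) (length-allVecs n) ⟩
  2 ^ n + 2 ^ n                                            ≡⟨ cong (2 ^ n +_) (+-identityʳ (2 ^ n)) ⟨
  2 ^ suc n                                                ∎
  where
  open ≡-Reasoning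
  vs = allVecs n

∈-allVecs : ∀ {n} (v : Vec Bool n) → v ∈ allVecs n
∈-allVecs []          = here refl
∈-allVecs (true ∷ v)  = ∈-++⁺ˡ (∈-map⁺ (true ∷_) (∈-allVecs v))
∈-allVecs (false ∷ v) = ∈-++⁺ʳ (map (true ∷_) (allVecs _)) (∈-map⁺ (false ∷_) (∈-allVecs v))

-- A pattern f : s → {0,1} is represented by any vector g extending it; entries of g outside s are ignored.
agreesOn : ∀ {n} → Subset n → Vec Bool n → Vec Bool n → Bool
agreesOn []            []      []      = true
agreesOn (inside ∷ s)  (x ∷ g) (y ∷ v) = isYes (x ≟ᵇ y) ∧ agreesOn s g v
agreesOn (outside ∷ s) (_ ∷ g) (_ ∷ v) = agreesOn s g v

agreesOn-refl : ∀ {n} (s : Subset n) v → T (agreesOn s v v)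
agreesOn-refl []            []      = _
agreesOn-refl (inside ∷ s)  (x ∷ v) =
  Equivalence.from T-∧ (fromWitness {a? = x ≟ᵇ x} refl , agreesOn-refl s v)
agreesOn-refl (outside ∷ s) (x ∷ v) = agreesOn-refl s v

agreesOn-sound : ∀ {n} (s : Subset n) g v → T (agreesOn s g v) →
                 ∀ j → j ∈ₛ s → lookup v j ≡ lookup g j
agreesOn-sound (inside ∷ s)  (x ∷ g) (y ∷ v) t zero    here        =
  sym (toWitness (proj₁ (Equivalence.to (T-∧ {isYes (x ≟ᵇ y)}) t)))
agreesOn-sound (inside ∷ s)  (x ∷ g) (y ∷ v) t (suc j) (there j∈s) =
  agreesOn-sound s g v (proj₂ (Equivalence.to (T-∧ {isYes (x ≟ᵇ y)}) t)) j j∈s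
agreesOn-sound (outside ∷ s) (x ∷ g) (y ∷ v) t (suc j) (there j∈s) = agreesOn-sound s g v t j j∈s

hits : ∀ {n} → Subset n → Vec Bool n → List (Vec Bool n) → ℕ
hits s g = length ∘ filter (T? ∘ agreesOn s g)

tailsWithHead : ∀ {n} → Bool → List (Vec Bool (suc n)) → List (Vec Bool n)
tailsWithHead b []            = []
tailsWithHead b ((x ∷ v) ∷ U) = if isYes (b ≟ᵇ x) then v ∷ tailsWithHead b U else tailsWithHead b U

length-tailsWithHead : ∀ {n} (U : List (Vec Bool (suc n))) →
                       length (tailsWithHead true U) + length (tailsWithHead false U) ≡ length U
length-tailsWithHead []                = refl
length-tailsWithHead ((true ∷ v) ∷ U)  = cong suc (length-tailsWithHead U)
length-tailsWithHead ((false ∷ v) ∷ U) = trans (+-suc _ _) (cong suc (length-tailsWithHead U))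

majorityHead : ∀ {n} (U : List (Vec Bool (suc n))) → ∃ λ b → length U ≤ 2 * length (tailsWithHead b U)
majorityHead U = [ (λ f≤t → true , ≤-trans (≤-reflexive (sym t+f≡)) (m+n≤2*m f≤t))
                 , (λ t≤f → false , ≤-trans (≤-reflexive (sym (trans (+-comm f t) t+f≡))) (m+n≤2*m t≤f))
                 ]′ (≤-total f t)
  where
  t = length (tailsWithHead true U)
  f = length (tailsWithHead false U)
  t+f≡ : t + f ≡ length U
  t+f≡ = length-tailsWithHead U

hits-[] : ∀ (U : List (Vec Bool 0)) → hits [] [] U ≡ length U
hits-[] []       = refl
hits-[] ([] ∷ U) = cong suc (hits-[] U)

hits-inside : ∀ {n} (s : Subset n) b g U → hits (inside ∷ s) (b ∷ g) U ≡ hits s g (tailsWithHead b U)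
hits-inside s b g []            = refl
hits-inside s b g ((x ∷ v) ∷ U) with b ≟ᵇ x
... | no _     = hits-inside s b g U
... | yes refl with agreesOn s g v
...   | true  = cong suc (hits-inside s b g U)
...   | false = hits-inside s b g U

hits-outside : ∀ {n} (s : Subset n) b g U → hits (outside ∷ s) (b ∷ g) U ≡ hits s g (map tail U)
hits-outside s b g []            = refl
hits-outside s b g ((x ∷ v) ∷ U) with agreesOn s g v
... | true  = cong suc (hits-outside s b g U)
... | false = hits-outside s b g U

popularPattern : ∀ {n} (s : Subset n) (U : List (Vec Bool n)) → ∃ λ g → length U ≤ 2 ^ ∣ s ∣ * hits s g U
popularPattern []            U = [] , ≤-reflexive (sym (trans (+-identityʳ _) (hits-[] U)))
popularPattern (outside ∷ s) U =
  let g , h = popularPattern s (map tail U)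
  in false ∷ g , subst₂ _≤_ (length-map tail U) (cong (2 ^ ∣ s ∣ *_) (sym (hits-outside s false g U))) h
popularPattern (inside ∷ s)  U =
  let b , hb = majorityHead U
      g , hg = popularPattern s (tailsWithHead b U)
      open ≤-Reasoning
  in b ∷ g , (begin
    length U                                       ≤⟨ hb ⟩
    2 * length (tailsWithHead b U)                 ≤⟨ *-monoʳ-≤ 2 hg ⟩
    2 * (2 ^ ∣ s ∣ * hits s g (tailsWithHead b U)) ≡⟨ *-assoc 2 (2 ^ ∣ s ∣) _ ⟨
    2 ^ suc ∣ s ∣ * hits s g (tailsWithHead b U)   ≡⟨ cong (2 ^ suc ∣ s ∣ *_) (hits-inside s b g U) ⟨
    2 ^ suc ∣ s ∣ * hits (inside ∷ s) (b ∷ g) U    ∎)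

cylinderSize : ∀ {n} → Subset n → ℕ
cylinderSize {n} s = 2 ^ (n ∸ ∣ s ∣)

2^∣s∣*cylinderSize≡2^n : ∀ {n} (s : Subset n) → 2 ^ ∣ s ∣ * cylinderSize s ≡ 2 ^ n
2^∣s∣*cylinderSize≡2^n {n} s =
  trans (sym (^-distribˡ-+-* 2 ∣ s ∣ (n ∸ ∣ s ∣))) (cong (2 ^_) (m+[n∸m]≡n (∣p∣≤n s)))

weight : ∀ {n m} → (Fin m → Subset n) → ℕ
weight J = sum (cylinderSize ∘ J)

product-cylinderSize : ∀ {n m} (J : Fin m → Subset n) →
                       product (cylinderSize ∘ J) * 2 ^ totalSize J ≡ (2 ^ n) ^ m
product-cylinderSize {m = zero}  J = refl
product-cylinderSize {n} {suc m} J = begin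
  a * P * 2 ^ (∣ s ∣ + S)          ≡⟨ cong (a * P *_) (^-distribˡ-+-* 2 ∣ s ∣ S) ⟩
  a * P * (2 ^ ∣ s ∣ * 2 ^ S)      ≡⟨ interchange a P (2 ^ ∣ s ∣) (2 ^ S) ⟩
  a * 2 ^ ∣ s ∣ * (P * 2 ^ S)
    ≡⟨ cong₂ _*_ (trans (*-comm a _) (2^∣s∣*cylinderSize≡2^n s)) (product-cylinderSize (J ∘ suc)) ⟩
  2 ^ n * (2 ^ n) ^ m              ∎
  where
  open ≡-Reasoning
  s = J zero
  a = cylinderSize s
  P = product (cylinderSize ∘ J ∘ suc)
  S = totalSize (J ∘ suc)

weight-large : ∀ {n m} (J : Fin m → Subset n) {K d} →
               K ^ m * 2 ^ (totalSize J + m) < (m * d) ^ m → 2 * (K * 2 ^ n) < weight J * d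
weight-large {n} {m} J {K} {d} h = ^-cancelʳ-< m (*-cancelʳ-< (2 ^ S) _ _ (begin-strict
  (2 * (K * N)) ^ m * 2 ^ S
    ≡⟨ cong (_* 2 ^ S) (trans (^-distribʳ-* 2 (K * N) m) (cong (2 ^ m *_) (^-distribʳ-* K N m))) ⟩
  2 ^ m * (K ^ m * N ^ m) * 2 ^ S  ≡⟨ regroup (2 ^ m) (K ^ m) (N ^ m) (2 ^ S) ⟩
  K ^ m * (2 ^ S * 2 ^ m) * N ^ m  ≡⟨ cong (λ z → K ^ m * z * N ^ m) (^-distribˡ-+-* 2 S m) ⟨
  K ^ m * 2 ^ (S + m) * N ^ m      <⟨ *-monoˡ-< (N ^ m) {{m^n≢0 N m {{m^n≢0 2 n}}}} h ⟩
  (m * d) ^ m * N ^ m              ≡⟨ cong₂ _*_ (^-distribʳ-* m d m) (sym (product-cylinderSize J)) ⟩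
  m ^ m * d ^ m * (P * 2 ^ S)      ≡⟨ regroup′ (m ^ m) (d ^ m) P (2 ^ S) ⟩
  d ^ m * (m ^ m * P) * 2 ^ S      ≤⟨ *-monoˡ-≤ (2 ^ S) (*-monoʳ-≤ (d ^ m) (am-gm m (cylinderSize ∘ J))) ⟩
  d ^ m * X ^ m * 2 ^ S
    ≡⟨ cong (_* 2 ^ S) (trans (*-comm (d ^ m) (X ^ m)) (sym (^-distribʳ-* X d m))) ⟩
  (X * d) ^ m * 2 ^ S              ∎))
  where
  open ≤-Reasoning
  N = 2 ^ n
  S = totalSize J
  P = product (cylinderSize ∘ J)
  X = weight J
  regroup : ∀ a b c e → a * (b * c) * e ≡ b * (e * a) * c
  regroup = solve-∀
  regroup′ : ∀ a b c e → a * b * (c * e) ≡ b * (a * c) * e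
  regroup′ = solve-∀

heavy⇒budget : ∀ n {m p d t} → (d * (n + 1) ∸ p) * 2 ^ n ≤ t * d → 2 ^ p < m ^ d →
               2 * 2 ^ n * pred (2 ^ n) ^ t < m * (2 ^ n) ^ t
heavy⇒budget n {m} {p} {d} {t} heavy 2^p<m^d = ^-cancelʳ-< d (begin-strict
  (2 * N * E ^ t) ^ d            ≡⟨ ^-distribʳ-* (2 * N) (E ^ t) d ⟩
  (2 * N) ^ d * (E ^ t) ^ d      ≡⟨ cong₂ _*_ (^-*-assoc 2 (suc n) d) (^-*-assoc E t d) ⟩
  2 ^ (suc n * d) * E ^ (t * d)  ≤⟨ *-monoˡ-≤ _ (^-monoʳ-≤ 2 exponent≤p+K) ⟩
  2 ^ (p + K) * E ^ (t * d)      ≡⟨ cong (_* E ^ (t * d)) (^-distribˡ-+-* 2 p K) ⟩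
  2 ^ p * 2 ^ K * E ^ (t * d)    ≡⟨ *-assoc (2 ^ p) _ _ ⟩
  2 ^ p * (2 ^ K * E ^ (t * d))  ≤⟨ *-monoʳ-≤ (2 ^ p) (2^k*[N-1]^e≤N^e K N {{m^n≢0 2 n}} heavy) ⟩
  2 ^ p * N ^ (t * d)            <⟨ *-monoˡ-< (N ^ (t * d)) {{m^n≢0 N (t * d) {{m^n≢0 2 n}}}} 2^p<m^d ⟩
  m ^ d * N ^ (t * d)            ≡⟨ cong (m ^ d *_) (^-*-assoc N t d) ⟨
  m ^ d * (N ^ t) ^ d            ≡⟨ ^-distribʳ-* m (N ^ t) d ⟨
  (m * N ^ t) ^ d                ∎)
  where
  open ≤-Reasoning
  N = 2 ^ n
  E = pred N
  K = d * (n + 1) ∸ p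
  exponent≤p+K : suc n * d ≤ p + K
  exponent≤p+K = ≤-trans (≤-reflexive (trans (*-comm (suc n) d) (cong (d *_) (+-comm 1 n)))) (m≤n+m∸n _ p)

Covered : ∀ {n m} → (Fin m → Subset n) → (Fin m → Vec Bool n) → Vec Bool n → Set
Covered J G v = ∃ λ i → T (agreesOn (J i) (G i) v)

coverEach : ∀ {n β} (J : Fin β → Subset n) (U : List (Vec Bool n)) → length U ≤ β →
            ∃ λ G → ∀ {v} → v ∈ U → Covered J G v
coverEach J []      _       = (λ _ → replicate _ false) , λ ()
coverEach J (w ∷ U) (s≤s h) = w Vector.∷ G , cover
  where
  G = proj₁ (coverEach (J ∘ suc) U h)
  cover : ∀ {v} → v ∈ w ∷ U → Covered J (w Vector.∷ G) v
  cover (here refl) = zero , agreesOn-refl (J zero) w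
  cover (there v∈U) = let i , t = proj₂ (coverEach (J ∘ suc) U h) v∈U in suc i , t

-- The budget reads |U| (1 - 1/N)^T < β + 1, where T = weight JA.
greedyCover : ∀ {n} α (JA : Fin α → Subset n) {β} (JB : Fin β → Subset n) (U : List (Vec Bool n)) →
              length U * pred (2 ^ n) ^ weight JA < suc β * (2 ^ n) ^ weight JA →
              ∃₂ λ GA GB → ∀ {v} → v ∈ U → Covered JA GA v ⊎ Covered JB GB v
greedyCover zero    JA JB U budget =
  let G , cover = coverEach JB U (s≤s⁻¹ (*-cancelʳ-< _ _ _ budget)) in (λ ()) , G , inj₂ ∘ cover
greedyCover {n} (suc α) JA {β} JB U budget = g Vector.∷ GA , GB , cover
  where
  s = JA zero
  g = proj₁ (popularPattern s U)
  agrees? = T? ∘ agreesOn s g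
  R = filter (∁? agrees?) U
  N = 2 ^ n
  a = cylinderSize s
  t = weight (JA ∘ suc)
  R-shrinks : length R * N ^ a ≤ length U * pred N ^ a
  R-shrinks = subst₂ (λ u M → length R * M ^ a ≤ u * pred M ^ a)
    (length-filter+filter-∁ agrees? U) (2^∣s∣*cylinderSize≡2^n s)
    (remainder-bound {q = 2 ^ ∣ s ∣} {a} (hits s g U) (length R)
      {{m^n≢0 2 ∣ s ∣}} {{m^n≢0 2 (n ∸ ∣ s ∣)}}
      (subst (_≤ 2 ^ ∣ s ∣ * hits s g U) (sym (length-filter+filter-∁ agrees? U))
        (proj₂ (popularPattern s U))))
  budget′ : length R * pred N ^ t < suc β * N ^ t
  budget′ = *-cancelʳ-< (N ^ a) _ _ (begin-strict
    length R * pred N ^ t * N ^ a         ≡⟨ xy∙z≈xz∙y (length R) _ _ ⟩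
    length R * N ^ a * pred N ^ t         ≤⟨ *-monoˡ-≤ _ R-shrinks ⟩
    length U * pred N ^ a * pred N ^ t    ≡⟨ *-assoc (length U) _ _ ⟩
    length U * (pred N ^ a * pred N ^ t)  ≡⟨ cong (length U *_) (^-distribˡ-+-* (pred N) a t) ⟨
    length U * pred N ^ (a + t)           <⟨ budget ⟩
    suc β * N ^ (a + t)                   ≡⟨ cong (suc β *_) (^-distribˡ-+-* N a t) ⟩
    suc β * (N ^ a * N ^ t)               ≡⟨ x∙yz≈xz∙y (suc β) (N ^ a) (N ^ t) ⟩
    suc β * N ^ t * N ^ a                 ∎)
    where open ≤-Reasoning
  rest = greedyCover α (JA ∘ suc) JB R budget′
  GA = proj₁ rest
  GB = proj₁ (proj₂ rest)
  cover : ∀ {v} → v ∈ U → Covered JA (g Vector.∷ GA) v ⊎ Covered JB GB v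
  cover v∈U with ∈⇒P⊎∈-filter-∁ agrees? v∈U
  ... | inj₁ agrees = inj₁ (zero , agrees)
  ... | inj₂ v∈R    = map₁ (λ (i , agrees) → suc i , agrees) (proj₂ (proj₂ rest) v∈R)

coverFromHeavy : ∀ {n α β} (JA : Fin α → Subset n) (JB : Fin β → Subset n) {p d} →
                 α ≤ suc β → 2 ^ p < (α + β) ^ d → (d * (n + 1) ∸ p) * 2 ^ n ≤ weight JA * d →
                 ∃₂ λ GA GB → ∀ v → Covered JA GA v ⊎ Covered JB GB v
coverFromHeavy {n} {α} {β} JA JB {p} {d} α≤1+β 2^p<m^d heavy =
  let GA , GB , cover = greedyCover α JA JB (allVecs n) budget in GA , GB , λ v → cover (∈-allVecs v)
  where
  N = 2 ^ n
  α+β≤2*[1+β] : α + β ≤ 2 * suc β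
  α+β≤2*[1+β] = ≤-trans (+-monoˡ-≤ β α≤1+β) (m+n≤2*m (n≤1+n β))
  budget : length (allVecs n) * pred N ^ weight JA < suc β * N ^ weight JA
  budget = subst (λ l → l * pred N ^ weight JA < suc β * N ^ weight JA) (sym (length-allVecs n))
    (*-cancelˡ-< 2 _ _ (begin-strict
      2 * (N * pred N ^ weight JA)   ≡⟨ *-assoc 2 N _ ⟨
      2 * N * pred N ^ weight JA     <⟨ heavy⇒budget n {α + β} {p} {d} {weight JA} heavy 2^p<m^d ⟩
      (α + β) * N ^ weight JA        ≤⟨ *-monoˡ-≤ _ α+β≤2*[1+β] ⟩
      2 * suc β * N ^ weight JA      ≡⟨ *-assoc 2 (suc β) _ ⟩
      2 * (suc β * N ^ weight JA)    ∎))
    where open ≤-Reasoning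

halves : ∀ m → ∃₂ λ c r → c + r ≡ m × r ≤ c × c ≤ suc r
halves zero    = 0 , 0 , refl , z≤n , z≤n
halves (suc m) =
  let c , r , c+r≡m , r≤c , c≤1+r = halves m
  in suc r , c , cong suc (trans (+-comm r c) c+r≡m) , c≤1+r , s≤s r≤c

coverHalves : ∀ {n} c r (J : Fin (c + r) → Subset n) {p d} → r ≤ c → c ≤ suc r → 2 ^ p < (c + r) ^ d →
              2 * ((d * (n + 1) ∸ p) * 2 ^ n) < weight J * d →
              ∃₂ λ GA GB → ∀ v → Covered (J ∘ (_↑ˡ r)) GA v ⊎ Covered (J ∘ (c ↑ʳ_)) GB v
coverHalves {n} c r J {p} {d} r≤c c≤1+r 2^p<m^d large =
  [ (λ JA-heavy → coverFromHeavy JA JB {p} {d} c≤1+r 2^p<m^d (<⇒≤ JA-heavy))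
  , (λ JB-heavy →
      let GB , GA , cover = coverFromHeavy JB JA {p} {d} (m≤n⇒m≤1+n r≤c) 2^p<[r+c]^d (<⇒≤ JB-heavy)
      in GA , GB , swap ∘ cover)
  ]′ (2*x<y+z⇒x<y⊎x<z (subst (2 * ((d * (n + 1) ∸ p) * 2 ^ n) <_) weight-split large))
  where
  JA = J ∘ (_↑ˡ r)
  JB = J ∘ (c ↑ʳ_)
  weight-split : weight J * d ≡ weight JA * d + weight JB * d
  weight-split = trans (cong (_* d) (sum-↑ c r (cylinderSize ∘ J))) (*-distribʳ-+ d (weight JA) (weight JB))
  2^p<[r+c]^d : 2 ^ p < (r + c) ^ d
  2^p<[r+c]^d = subst (λ k → 2 ^ p < k ^ d) (+-comm c r) 2^p<m^d

covered-++ : ∀ {n c r} (J : Fin (c + r) → Subset n) GA GB {v} →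
             Covered (J ∘ (_↑ˡ r)) GA v ⊎ Covered (J ∘ (c ↑ʳ_)) GB v → Covered J (GA Vector.++ GB) v
covered-++ {r = r} J GA GB {v} (inj₁ (i , t)) =
  i ↑ˡ r , subst (λ g → T (agreesOn (J (i ↑ˡ r)) g v)) (sym (lookup-++ˡ GA GB i)) t
covered-++ {c = c} J GA GB {v} (inj₂ (i , t)) =
  c ↑ʳ i , subst (λ g → T (agreesOn (J (c ↑ʳ i)) g v)) (sym (lookup-++ʳ GA GB i)) t

covering-from-patterns : ∀ {n m} (J : Fin m → Subset n) (G : Fin m → Vec Bool n) →
                         (∀ v → Covered J G v) → HasCoveringAssignment J
covering-from-patterns J G cover = (λ i j _ → lookup (G i) j) , restricts
  where
  restricts : IsCovering J (λ i j _ → lookup (G i) j)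
  restricts v =
    let i , t = cover (tabulate v)
    in i , λ j j∈Jᵢ → trans (sym (lookup∘tabulate v j)) (agreesOn-sound (J i) (G i) (tabulate v) t j j∈Jᵢ)

lemma3p4 : (n m : ℕ) → 0 < n → n < m → m < 2 ^ n →
           (J : Fin m → Subset n) →
           LogBound n m (totalSize J) →
           HasCoveringAssignment J
lemma3p4 n m _ _ _ J (p , d , _ , 2^p<m^d , bound) with halves m
... | c , r , refl , r≤c , c≤1+r =
  let GA , GB , cover = coverHalves c r J {p} {d} r≤c c≤1+r 2^p<m^d (weight-large J bound)
  in covering-from-patterns J (GA Vector.++ GB) (covered-++ J GA GB ∘ cover)
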